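{- Let $n\in\mathbb{N}_0$ and integers $0\le k\le n$, $\ell\ge0$. The number of non-attacking mixed placements of $k$ rooks and $\ell$ files on the staircase board $J_n$ satisfies $$|\mathcal{M}_{k,\ell}(J_n)|=r_k(J_n)\,f_\ell(J_{n-k}).$$ Consequently, for $\mu,\nu\in\mathbb{C}$ and $X,Y$ satisfying $XY-YX=\mu I+\nu Y$, one has $$(YX)^n=\sum_{r=0}^{n}\sum_{t=0}^{r}\mu^{n-r}\nu^{r-t}S(n,r)\,|s(r,t)|\,Y^rX^t,$$ where $S(n,r)$ are the Stirling numbers of the second kind and $|s(r,t)|$ the unsigned Stirling numbers of the first kind.
   Context: The staircase board $J_n$ is the Ferrers board with top-aligned columns of heights $n-1,n-2,\dots,1,0$ from left to right ($J_0$ is empty). For a Ferrers board $B$: $r_k(B)$ is the number of ways to place $k$ rooks in cells of $B$ with no two in the same row or column; $f_\ell(B)$ is the number of ways to place $\ell$ files (rooks) in cells of $B$ with at most one in each column. $\mathcal{M}_{k,\ell}(B)$ is the set of placements of $k$ rooks and $\ell$ files in distinct cells of $B$ such that no two rooks share a row or column, no two files share a column, no file and rook share a column, and no file lies in the same row as a rook and to its left. -}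

module Defs where

import Data.Nat as ℕ
open import Data.Nat using (ℕ; zero; suc; _+_; _∸_; _≡ᵇ_)
open import Data.Bool using (Bool; true; false; _∧_; _∨_; not; if_then_else_)
open import Data.List using (List; []; _∷_; map; _++_; length; upTo; filterᵇ; concatMap)
open import Data.Fin using (Fin; toℕ)
import Algebra.Bundles
open Algebra.Bundles using (Ring)
open import Level using (Level)

-- Ferrers boards, given by their (top-aligned) column heights, listed
-- from left to right.  A cell is (row i, column j) with i < height of
-- column j (row 0 is the top row).

Board : Set
Board = List ℕ

J : ℕ → Board
J zero    = []
J (suc n) = n ∷ J n

-- In every configuration considered here (rook placements,
-- file placements, mixed placements) each column contains at most one
-- piece (rooks pairwise differ in column, files pairwise differ in
-- column, a file and a rook never share a column).  Hence a placement is
-- exactly the choice, for every column, of: nothing, a rook in row i,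
-- or a file in row i (i < height of that column).  Distinct-cell
-- condition is then automatic.

data Slot : Set where
  empty : Slot
  rook  : ℕ → Slot
  file  : ℕ → Slot

columnChoices : ℕ → List Slot
columnChoices h = empty ∷ (map rook (upTo h) ++ map file (upTo h))

assignments : Board → List (List Slot)
assignments []       = [] ∷ []
assignments (h ∷ hs) =
  concatMap (λ s → map (s ∷_) (assignments hs)) (columnChoices h)

isRook : Slot → Bool
isRook (rook _) = true
isRook _        = false

isFile : Slot → Bool
isFile (file _) = true
isFile _        = false

countRooks : List Slot → ℕ
countRooks []       = 0
countRooks (s ∷ ss) = (if isRook s then 1 else 0) + countRooks ss

countFiles : List Slot → ℕ
countFiles []       = 0
countFiles (s ∷ ss) = (if isFile s then 1 else 0) + countFiles ss

rookInRow : ℕ → List Slot → Bool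
rookInRow i []            = false
rookInRow i (rook j ∷ ss) = (i ≡ᵇ j) ∨ rookInRow i ss
rookInRow i (_      ∷ ss) = rookInRow i ss

rooksNonAttacking : List Slot → Bool
rooksNonAttacking []            = true
rooksNonAttacking (rook i ∷ ss) = not (rookInRow i ss) ∧ rooksNonAttacking ss
rooksNonAttacking (_      ∷ ss) = rooksNonAttacking ss

noFileLeftOfRook : List Slot → Bool
noFileLeftOfRook []            = true
noFileLeftOfRook (file i ∷ ss) = not (rookInRow i ss) ∧ noFileLeftOfRook ss
noFileLeftOfRook (_      ∷ ss) = noFileLeftOfRook ss

rookOnly : List Slot → Bool
rookOnly []       = true
rookOnly (s ∷ ss) = not (isFile s) ∧ rookOnly ss

fileOnly : List Slot → Bool
fileOnly []       = true
fileOnly (s ∷ ss) = not (isRook s) ∧ fileOnly ss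

r : ℕ → Board → ℕ
r k B = length (filterᵇ (λ p → rookOnly p ∧ (countRooks p ≡ᵇ k) ∧ rooksNonAttacking p)
                        (assignments B))

f : ℕ → Board → ℕ
f ℓ B = length (filterᵇ (λ p → fileOnly p ∧ (countFiles p ≡ᵇ ℓ)) (assignments B))

M : ℕ → ℕ → Board → ℕ
M k ℓ B = length (filterᵇ (λ p → (countRooks p ≡ᵇ k) ∧ (countFiles p ≡ᵇ ℓ)
                                 ∧ rooksNonAttacking p ∧ noFileLeftOfRook p)
                          (assignments B))

S₂ : ℕ → ℕ → ℕ
S₂ zero    zero    = 1
S₂ zero    (suc k) = 0
S₂ (suc n) zero    = 0
S₂ (suc n) (suc k) = suc k ℕ.* S₂ n (suc k) + S₂ n k

c₁ : ℕ → ℕ → ℕ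
c₁ zero    zero    = 1
c₁ zero    (suc k) = 0
c₁ (suc n) zero    = 0
c₁ (suc n) (suc k) = n ℕ.* c₁ n (suc k) + c₁ n k

module _ {c ℓ : Level} (R : Ring c ℓ) where
  open Ring R using (Carrier; _*_; semiring)
  open import Algebra.Definitions.RawSemiring (Algebra.Bundles.Semiring.rawSemiring semiring) using (_^_; _×_; sum)

  normalOrderedSum : Carrier → Carrier → Carrier → Carrier → ℕ → Carrier
  normalOrderedSum μ ν X Y n =
    sum {suc n} (λ (i : Fin (suc n)) → let rr = toℕ i in
      sum {suc rr} (λ (j : Fin (suc rr)) → let t = toℕ j in
        ((S₂ n rr ℕ.* c₁ rr t) × ((μ ^ (n ∸ rr)) * (ν ^ (rr ∸ t))))
          * ((Y ^ rr) * (X ^ t))))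

  YXpow : Carrier → Carrier → ℕ → Carrier
  YXpow X Y n = (Y * X) ^ n

module Submission where

-- Removing the leftmost column (of height n) of J (n + 1) leaves J n.  A rook or a file put
-- into that column must avoid the rows of the rooks already placed, and k non-attacking rooks
-- on J n leave exactly n ∸ k free rows.  This gives one recurrence in n for M k ℓ (J n); its
-- cases ℓ = 0 and k = 0 are the recurrences of r k = M k 0 and f ℓ = M 0 ℓ, and the
-- factorisation follows by induction on n.
--
-- For the normal ordering: if s is central, P 0 = 1 and T n * P k = P (k + 1) + w n k · s * P k,
-- then T (n - 1) * ⋯ * T 0 = ∑ₖ a n k · s ^ (n ∸ k) * P k, where a is the triangle with
-- a (n + 1) k = w n k · a n k + a n (k - 1).  With T r = X + r · ν and P t = X ^ t this expands
-- the rising product X (X + ν) ⋯ (X + (r - 1) ν) in unsigned Stirling numbers of the first kind.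
-- With T = Y X and P r = Y ^ r times that rising product, X Y - Y X = μ + ν Y gives
-- Y X * P r = P (r + 1) + r · μ * P r, which expands (Y X) ^ n in Stirling numbers of the second kind.

open import Defs
open import Data.Nat as ℕ using (ℕ; zero; suc; _<_; s≤s)
open import Data.Nat.Properties using (+-∸-assoc; m<n⇒m<1+n; n<1+n; *-zeroʳ; ≮⇒≥)
open import Relation.Nullary using (yes; no)
open import Data.Fin using (toℕ)
open import Relation.Binary.PropositionalEquality as ≡ using (_≡_)
open import Algebra.Bundles using (Ring; Semiring)

suc[n∸suc-k]≡n∸k : ∀ {n k} → k < n → suc (n ℕ.∸ suc k) ≡ n ℕ.∸ k
suc[n∸suc-k]≡n∸k {suc n} (s≤s k≤n) = ≡.sym (+-∸-assoc 1 k≤n)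

module Placements where

  open import Data.Nat using (_+_; _*_; _∸_; _≤_; _≡ᵇ_)
  open import Data.Nat.Properties
  open import Data.Nat.Tactic.RingSolver using (solve-∀)
  open import Algebra.Properties.CommutativeSemigroup +-commutativeSemigroup using (interchange)
  open import Data.Bool using (Bool; true; false; _∧_; _∨_; not; T)
  open import Data.Bool.Properties using (∧-zeroʳ; ∧-identityʳ; T-∧)
  open import Data.List using (List; []; _∷_; map; _++_; length; upTo; applyUpTo; filterᵇ; concatMap)
  open import Data.List.Properties using (map-upTo; length-upTo)
  open import Data.List.Relation.Unary.All as All using (All; []; _∷_)
  import Data.List.Relation.Unary.All.Properties as All
  open import Data.Product using (_×_; _,_; proj₁; proj₂)
  open import Data.Unit using (⊤; tt)
  open import Function using (_∘_; Equivalence)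
  open import Relation.Binary.PropositionalEquality using (_≡_; refl; sym; trans; cong; cong₂; module ≡-Reasoning)
  open ≡-Reasoning

  private variable X Y : Set

  ∑ : List X → (X → ℕ) → ℕ
  ∑ []       w = 0
  ∑ (x ∷ xs) w = w x + ∑ xs w

  infix 5 ∑
  syntax ∑ xs (λ x → e) = ∑[ x ∈ xs ] e

  ∑-++ : ∀ (xs ys : List X) w → ∑ (xs ++ ys) w ≡ ∑ xs w + ∑ ys w
  ∑-++ []       ys w = refl
  ∑-++ (x ∷ xs) ys w = trans (cong (w x +_) (∑-++ xs ys w)) (sym (+-assoc (w x) _ _))

  ∑-map : ∀ (f : X → Y) xs w → ∑ (map f xs) w ≡ ∑ xs (w ∘ f)
  ∑-map f []       w = refl
  ∑-map f (x ∷ xs) w = cong (w (f x) +_) (∑-map f xs w)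

  ∑-concatMap : ∀ (F : X → List Y) xs w → ∑ (concatMap F xs) w ≡ ∑[ x ∈ xs ] ∑ (F x) w
  ∑-concatMap F []       w = refl
  ∑-concatMap F (x ∷ xs) w = trans (∑-++ (F x) _ w) (cong (∑ (F x) w +_) (∑-concatMap F xs w))

  ∑-congᴬ : ∀ {xs : List X} {v w} → All (λ x → v x ≡ w x) xs → ∑ xs v ≡ ∑ xs w
  ∑-congᴬ []       = refl
  ∑-congᴬ (e ∷ es) = cong₂ _+_ e (∑-congᴬ es)

  ∑-cong : ∀ (xs : List X) {v w} → (∀ x → v x ≡ w x) → ∑ xs v ≡ ∑ xs w
  ∑-cong xs v≗w = ∑-congᴬ {xs = xs} (All.tabulate (λ {x} _ → v≗w x))

  ∑-zero : ∀ (xs : List X) {w} → (∀ x → w x ≡ 0) → ∑ xs w ≡ 0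
  ∑-zero []       w≗0 = refl
  ∑-zero (x ∷ xs) w≗0 = cong₂ _+_ (w≗0 x) (∑-zero xs w≗0)

  ∑-const : ∀ (xs : List X) c → ∑[ _ ∈ xs ] c ≡ length xs * c
  ∑-const []       c = refl
  ∑-const (x ∷ xs) c = cong (c +_) (∑-const xs c)

  ∑-*ˡ : ∀ c (xs : List X) w → ∑[ x ∈ xs ] c * w x ≡ c * ∑ xs w
  ∑-*ˡ c []       w = sym (*-zeroʳ c)
  ∑-*ˡ c (x ∷ xs) w = trans (cong (c * w x +_) (∑-*ˡ c xs w)) (sym (*-distribˡ-+ c (w x) _))

  ∑-+ : ∀ (xs : List X) v w → ∑[ x ∈ xs ] (v x + w x) ≡ ∑ xs v + ∑ xs w
  ∑-+ []       v w = refl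
  ∑-+ (x ∷ xs) v w = trans (cong (v x + w x +_) (∑-+ xs v w)) (interchange (v x) (w x) _ _)

  ∑-comm : ∀ (xs : List X) (ys : List Y) (g : X → Y → ℕ) →
           ∑[ x ∈ xs ] ∑[ y ∈ ys ] g x y ≡ ∑[ y ∈ ys ] ∑[ x ∈ xs ] g x y
  ∑-comm []       ys g = sym (∑-zero ys (λ _ → refl))
  ∑-comm (x ∷ xs) ys g = trans (cong (∑ ys (g x) +_) (∑-comm xs ys g)) (sym (∑-+ ys (g x) _))

  ∑-upTo-suc : ∀ n g → ∑ (upTo (suc n)) g ≡ g 0 + (∑[ i ∈ upTo n ] g (suc i))
  ∑-upTo-suc n g = cong (g 0 +_) (begin
    ∑ (applyUpTo suc n) g    ≡⟨ cong (λ xs → ∑ xs g) (map-upTo suc n) ⟨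
    ∑ (map suc (upTo n)) g   ≡⟨ ∑-map suc (upTo n) g ⟩
    ∑[ i ∈ upTo n ] g (suc i) ∎)

  ⟦_⟧ : Bool → ℕ
  ⟦ true  ⟧ = 1
  ⟦ false ⟧ = 0

  ⟦∧⟧ : ∀ a b → ⟦ a ∧ b ⟧ ≡ ⟦ a ⟧ * ⟦ b ⟧
  ⟦∧⟧ true  b = sym (+-identityʳ ⟦ b ⟧)
  ⟦∧⟧ false b = refl

  T-∧⁻ : ∀ {a b} → T (a ∧ b) → T a × T b
  T-∧⁻ {a} {b} = Equivalence.to (T-∧ {a} {b})

  ∧-∧-false : ∀ a b → a ∧ b ∧ false ≡ false
  ∧-∧-false a b = trans (cong (a ∧_) (∧-zeroʳ b)) (∧-zeroʳ a)

  length-filterᵇ : ∀ (P : X → Bool) xs → length (filterᵇ P xs) ≡ ∑[ x ∈ xs ] ⟦ P x ⟧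
  length-filterᵇ P []       = refl
  length-filterᵇ P (x ∷ xs) with P x
  ... | true  = cong suc (length-filterᵇ P xs)
  ... | false = length-filterᵇ P xs

  Placement : Set
  Placement = List Slot

  count : (Placement → Bool) → Board → ℕ
  count P B = ∑[ p ∈ assignments B ] ⟦ P p ⟧

  count-cong : ∀ {P Q} B → (∀ p → P p ≡ Q p) → count P B ≡ count Q B
  count-cong B P≗Q = ∑-cong (assignments B) (λ p → cong ⟦_⟧ (P≗Q p))

  count-false : ∀ {P} B → (∀ p → P p ≡ false) → count P B ≡ 0
  count-false B P≗false = ∑-zero (assignments B) (λ p → cong ⟦_⟧ (P≗false p))

  count-∷ : ∀ P h hs → count P (h ∷ hs) ≡
    count (λ p → P (empty ∷ p)) hs
    + ((∑[ i ∈ upTo h ] count (λ p → P (rook i ∷ p)) hs)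
      + (∑[ i ∈ upTo h ] count (λ p → P (file i ∷ p)) hs))
  count-∷ P h hs = begin
    ∑ (concatMap (λ s → map (s ∷_) (assignments hs)) (columnChoices h)) w
      ≡⟨ ∑-concatMap (λ s → map (s ∷_) (assignments hs)) (columnChoices h) w ⟩
    ∑[ s ∈ columnChoices h ] ∑ (map (s ∷_) (assignments hs)) w
      ≡⟨ ∑-cong (columnChoices h) (λ s → ∑-map (s ∷_) (assignments hs) w) ⟩
    ∑[ s ∈ columnChoices h ] c s
      ≡⟨ cong (c empty +_) (∑-++ (map rook (upTo h)) (map file (upTo h)) c) ⟩
    c empty + (∑ (map rook (upTo h)) c + ∑ (map file (upTo h)) c)
      ≡⟨ cong (c empty +_) (cong₂ _+_ (∑-map rook (upTo h) c) (∑-map file (upTo h) c)) ⟩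
    c empty + ((∑[ i ∈ upTo h ] c (rook i)) + (∑[ i ∈ upTo h ] c (file i))) ∎
    where
    w : Placement → ℕ
    w p = ⟦ P p ⟧
    c : Slot → ℕ
    c s = count (λ p → P (s ∷ p)) hs

  SlotBelow : ℕ → Slot → Set
  SlotBelow m empty    = ⊤
  SlotBelow m (rook i) = i < m
  SlotBelow m (file i) = i < m

  columnChoices-below : ∀ {m h} → h ≤ m → All (SlotBelow m) (columnChoices h)
  columnChoices-below {m} {h} h≤m = tt ∷ All.++⁺ (All.map⁺ rows) (All.map⁺ rows)
    where
    rows : All (_< m) (upTo h)
    rows = All.applyUpTo⁺₁ (λ i → i) h (λ i<h → <-≤-trans i<h h≤m)

  assignments-below : ∀ {m B} → All (_≤ m) B → All (All (SlotBelow m)) (assignments B)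
  assignments-below []          = [] ∷ []
  assignments-below {m} {h ∷ hs} (h≤m ∷ hs≤m) = All.concat⁺ (All.map⁺ (All.map extend (columnChoices-below h≤m)))
    where
    extend : ∀ {s} → SlotBelow m s → All (All (SlotBelow m)) (map (s ∷_) (assignments hs))
    extend s-below = All.map⁺ (All.map (s-below ∷_) (assignments-below hs≤m))

  J-heights : ∀ n → All (_≤ n) (J n)
  J-heights zero    = []
  J-heights (suc n) = n≤1+n n ∷ All.map (m≤n⇒m≤1+n) (J-heights n)

  countFalse : ℕ → (ℕ → Bool) → ℕ
  countFalse m b = ∑[ i ∈ upTo m ] ⟦ not (b i) ⟧

  countFalse-suc : ∀ m b → countFalse (suc m) b ≡ ⟦ not (b 0) ⟧ + countFalse m (λ i → b (suc i))
  countFalse-suc m b = ∑-upTo-suc m (λ i → ⟦ not (b i) ⟧)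

  ⟦⟧-T : ∀ {b} → T b → ⟦ b ⟧ ≡ 1
  ⟦⟧-T {true} _ = refl

  countFalse-remove : ∀ m j (b : ℕ → Bool) → j < m → T (not (b j)) →
    countFalse m (λ i → (i ≡ᵇ j) ∨ b i) + 1 ≡ countFalse m b
  countFalse-remove (suc m) zero b _ ¬b0 = begin
    countFalse (suc m) (λ i → (i ≡ᵇ 0) ∨ b i) + 1  ≡⟨ cong (_+ 1) (countFalse-suc m (λ i → (i ≡ᵇ 0) ∨ b i)) ⟩
    countFalse m (λ i → b (suc i)) + 1             ≡⟨ +-comm _ 1 ⟩
    1 + countFalse m (λ i → b (suc i))             ≡⟨ cong (_+ countFalse m (λ i → b (suc i))) (⟦⟧-T ¬b0) ⟨
    ⟦ not (b 0) ⟧ + countFalse m (λ i → b (suc i)) ≡⟨ countFalse-suc m b ⟨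
    countFalse (suc m) b                           ∎
  countFalse-remove (suc m) (suc j) b (s≤s j<m) ¬bj = begin
    countFalse (suc m) (λ i → (i ≡ᵇ suc j) ∨ b i) + 1
      ≡⟨ cong (_+ 1) (countFalse-suc m (λ i → (i ≡ᵇ suc j) ∨ b i)) ⟩
    ⟦ not (b 0) ⟧ + countFalse m (λ i → (i ≡ᵇ j) ∨ b (suc i)) + 1
      ≡⟨ +-assoc ⟦ not (b 0) ⟧ _ 1 ⟩
    ⟦ not (b 0) ⟧ + (countFalse m (λ i → (i ≡ᵇ j) ∨ b (suc i)) + 1)
      ≡⟨ cong (⟦ not (b 0) ⟧ +_) (countFalse-remove m j (λ i → b (suc i)) j<m ¬bj) ⟩
    ⟦ not (b 0) ⟧ + countFalse m (λ i → b (suc i))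
      ≡⟨ countFalse-suc m b ⟨
    countFalse (suc m) b ∎

  freeRows : ℕ → Placement → ℕ
  freeRows m p = countFalse m (λ i → rookInRow i p)

  freeRows+countRooks : ∀ m p → All (SlotBelow m) p → T (rooksNonAttacking p) → freeRows m p + countRooks p ≡ m
  freeRows+countRooks m [] [] _ = begin
    (∑[ _ ∈ upTo m ] 1) + 0 ≡⟨ +-identityʳ _ ⟩
    (∑[ _ ∈ upTo m ] 1)     ≡⟨ ∑-const (upTo m) 1 ⟩
    length (upTo m) * 1     ≡⟨ cong (_* 1) (length-upTo m) ⟩
    m * 1                   ≡⟨ *-identityʳ m ⟩
    m                       ∎
  freeRows+countRooks m (empty  ∷ p) (_ ∷ below) safe = freeRows+countRooks m p below safe
  freeRows+countRooks m (file i ∷ p) (_ ∷ below) safe = freeRows+countRooks m p below safe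
  freeRows+countRooks m (rook j ∷ p) (j<m ∷ below) safe = begin
    freeRows m (rook j ∷ p) + suc (countRooks p)
      ≡⟨ +-assoc (freeRows m (rook j ∷ p)) 1 _ ⟨
    freeRows m (rook j ∷ p) + 1 + countRooks p
      ≡⟨ cong (_+ countRooks p) (countFalse-remove m j (λ i → rookInRow i p) j<m row-j-free) ⟩
    freeRows m p + countRooks p
      ≡⟨ freeRows+countRooks m p below rest-safe ⟩
    m ∎
    where
    row-j-free : T (not (rookInRow j p))
    row-j-free = proj₁ (T-∧⁻ safe)
    rest-safe : T (rooksNonAttacking p)
    rest-safe = proj₂ (T-∧⁻ safe)

  ∑-freeRows : ∀ {m c} Q B → All (_≤ m) B →
    (∀ p → T (Q p) → T (rooksNonAttacking p) × countRooks p ≡ c) →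
    ∑[ i ∈ upTo m ] count (λ p → not (rookInRow i p) ∧ Q p) B ≡ (m ∸ c) * count Q B
  ∑-freeRows {m} {c} Q B B≤m valid = begin
    ∑[ i ∈ upTo m ] ∑[ p ∈ As ] ⟦ not (rookInRow i p) ∧ Q p ⟧
      ≡⟨ ∑-cong (upTo m) (λ i → ∑-cong As (λ p → trans (⟦∧⟧ _ (Q p)) (*-comm _ ⟦ Q p ⟧))) ⟩
    ∑[ i ∈ upTo m ] ∑[ p ∈ As ] ⟦ Q p ⟧ * ⟦ not (rookInRow i p) ⟧
      ≡⟨ ∑-comm (upTo m) As (λ i p → ⟦ Q p ⟧ * ⟦ not (rookInRow i p) ⟧) ⟩
    ∑[ p ∈ As ] ∑[ i ∈ upTo m ] ⟦ Q p ⟧ * ⟦ not (rookInRow i p) ⟧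
      ≡⟨ ∑-cong As (λ p → ∑-*ˡ ⟦ Q p ⟧ (upTo m) (λ i → ⟦ not (rookInRow i p) ⟧)) ⟩
    ∑[ p ∈ As ] ⟦ Q p ⟧ * freeRows m p
      ≡⟨ ∑-congᴬ (All.map (λ {p} → term p) (assignments-below B≤m)) ⟩
    ∑[ p ∈ As ] (m ∸ c) * ⟦ Q p ⟧
      ≡⟨ ∑-*ˡ (m ∸ c) As (λ p → ⟦ Q p ⟧) ⟩
    (m ∸ c) * count Q B ∎
    where
    As = assignments B
    term : ∀ p → All (SlotBelow m) p → ⟦ Q p ⟧ * freeRows m p ≡ (m ∸ c) * ⟦ Q p ⟧
    term p below with Q p | valid p
    ... | false | _ = sym (*-zeroʳ (m ∸ c))
    ... | true  | v with v tt
    ...   | safe , refl = begin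
      freeRows m p + 0                           ≡⟨ +-identityʳ _ ⟩
      freeRows m p                               ≡⟨ m+n∸n≡m (freeRows m p) (countRooks p) ⟨
      freeRows m p + countRooks p ∸ countRooks p ≡⟨ cong (_∸ countRooks p) (freeRows+countRooks m p below safe) ⟩
      m ∸ countRooks p                           ≡⟨ *-identityʳ _ ⟨
      (m ∸ countRooks p) * 1                     ∎

  isMixed : ℕ → ℕ → Placement → Bool
  isMixed k ℓ p = (countRooks p ≡ᵇ k) ∧ (countFiles p ≡ᵇ ℓ) ∧ rooksNonAttacking p ∧ noFileLeftOfRook p

  M≡count : ∀ k ℓ B → M k ℓ B ≡ count (isMixed k ℓ) B
  M≡count k ℓ B = length-filterᵇ (isMixed k ℓ) (assignments B)

  isMixed-valid : ∀ k ℓ p → T (isMixed k ℓ p) → T (rooksNonAttacking p) × countRooks p ≡ k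
  isMixed-valid k ℓ p mixed = proj₁ (T-∧⁻ attacks-ok) , ≡ᵇ⇒≡ (countRooks p) k (proj₁ (T-∧⁻ mixed))
    where
    attacks-ok : T (rooksNonAttacking p ∧ noFileLeftOfRook p)
    attacks-ok = proj₂ (T-∧⁻ {countFiles p ≡ᵇ ℓ} (proj₂ (T-∧⁻ {countRooks p ≡ᵇ k} mixed)))

  isMixed-rook : ∀ k ℓ i p → isMixed (suc k) ℓ (rook i ∷ p) ≡ not (rookInRow i p) ∧ isMixed k ℓ p
  isMixed-rook k ℓ i p with rookInRow i p
  ... | false = refl
  ... | true  = ∧-∧-false (countRooks p ≡ᵇ k) (countFiles p ≡ᵇ ℓ)

  isMixed-file : ∀ k ℓ i p → isMixed k (suc ℓ) (file i ∷ p) ≡ not (rookInRow i p) ∧ isMixed k ℓ p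
  isMixed-file k ℓ i p with rookInRow i p
  ... | false = refl
  ... | true  = trans (cong ((countRooks p ≡ᵇ k) ∧_) (∧-∧-false (countFiles p ≡ᵇ ℓ) (rooksNonAttacking p)))
                      (∧-zeroʳ (countRooks p ≡ᵇ k))

  isMixed-file-0 : ∀ k i p → isMixed k 0 (file i ∷ p) ≡ false
  isMixed-file-0 k i p = ∧-zeroʳ (countRooks p ≡ᵇ k)

  pieceInFirstColumn : ∀ n k ℓ (P : Placement → Bool) (piece : ℕ → Slot) →
    (∀ i p → P (piece i ∷ p) ≡ not (rookInRow i p) ∧ isMixed k ℓ p) →
    ∑[ i ∈ upTo n ] count (λ p → P (piece i ∷ p)) (J n) ≡ (n ∸ k) * M k ℓ (J n)
  pieceInFirstColumn n k ℓ P piece guarded = begin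
    ∑[ i ∈ upTo n ] count (λ p → P (piece i ∷ p)) (J n)
      ≡⟨ ∑-cong (upTo n) (λ i → count-cong (J n) (guarded i)) ⟩
    ∑[ i ∈ upTo n ] count (λ p → not (rookInRow i p) ∧ isMixed k ℓ p) (J n)
      ≡⟨ ∑-freeRows (isMixed k ℓ) (J n) (J-heights n) (isMixed-valid k ℓ) ⟩
    (n ∸ k) * count (isMixed k ℓ) (J n)
      ≡⟨ cong ((n ∸ k) *_) (M≡count k ℓ (J n)) ⟨
    (n ∸ k) * M k ℓ (J n) ∎

  rookInFirstColumn : ℕ → ℕ → ℕ → ℕ
  rookInFirstColumn n zero    ℓ = 0
  rookInFirstColumn n (suc k) ℓ = (n ∸ k) * M k ℓ (J n)

  fileInFirstColumn : ℕ → ℕ → ℕ → ℕ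
  fileInFirstColumn n k zero    = 0
  fileInFirstColumn n k (suc ℓ) = (n ∸ k) * M k ℓ (J n)

  M-J-suc : ∀ n k ℓ → M k ℓ (J (suc n)) ≡ M k ℓ (J n) + (rookInFirstColumn n k ℓ + fileInFirstColumn n k ℓ)
  M-J-suc n k ℓ = begin
    M k ℓ (J (suc n))             ≡⟨ M≡count k ℓ (J (suc n)) ⟩
    count (isMixed k ℓ) (n ∷ J n) ≡⟨ count-∷ (isMixed k ℓ) n (J n) ⟩
    _                             ≡⟨ cong₂ _+_ (sym (M≡count k ℓ (J n))) (cong₂ _+_ (rooks k) (files ℓ)) ⟩
    M k ℓ (J n) + (rookInFirstColumn n k ℓ + fileInFirstColumn n k ℓ) ∎
    where
    rooks : ∀ k → ∑[ i ∈ upTo n ] count (λ p → isMixed k ℓ (rook i ∷ p)) (J n) ≡ rookInFirstColumn n k ℓ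
    rooks zero    = ∑-zero (upTo n) (λ i → count-false (J n) (λ p → refl))
    rooks (suc k) = pieceInFirstColumn n k ℓ (isMixed (suc k) ℓ) rook (isMixed-rook k ℓ)
    files : ∀ ℓ → ∑[ i ∈ upTo n ] count (λ p → isMixed k ℓ (file i ∷ p)) (J n) ≡ fileInFirstColumn n k ℓ
    files zero    = ∑-zero (upTo n) (λ i → count-false (J n) (isMixed-file-0 k i))
    files (suc ℓ) = pieceInFirstColumn n k ℓ (isMixed k (suc ℓ)) file (isMixed-file k ℓ)

  rookOnly≡noFiles : ∀ p → rookOnly p ≡ (countFiles p ≡ᵇ 0)
  rookOnly≡noFiles []           = refl
  rookOnly≡noFiles (empty  ∷ p) = rookOnly≡noFiles p
  rookOnly≡noFiles (rook i ∷ p) = rookOnly≡noFiles p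
  rookOnly≡noFiles (file i ∷ p) = refl

  noFiles⇒noFileLeftOfRook : ∀ p → (countFiles p ≡ᵇ 0) ≡ true → noFileLeftOfRook p ≡ true
  noFiles⇒noFileLeftOfRook []           _ = refl
  noFiles⇒noFileLeftOfRook (empty  ∷ p) = noFiles⇒noFileLeftOfRook p
  noFiles⇒noFileLeftOfRook (rook i ∷ p) = noFiles⇒noFileLeftOfRook p

  r≡M : ∀ k B → r k B ≡ M k 0 B
  r≡M k B = begin
    r k B
      ≡⟨ length-filterᵇ _ (assignments B) ⟩
    count (λ p → rookOnly p ∧ (countRooks p ≡ᵇ k) ∧ rooksNonAttacking p) B
      ≡⟨ count-cong B same ⟩
    count (isMixed k 0) B
      ≡⟨ M≡count k 0 B ⟨
    M k 0 B ∎
    where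
    same : ∀ p → rookOnly p ∧ (countRooks p ≡ᵇ k) ∧ rooksNonAttacking p ≡ isMixed k 0 p
    same p rewrite rookOnly≡noFiles p with countFiles p ≡ᵇ 0 in noFiles
    ... | false = sym (∧-zeroʳ (countRooks p ≡ᵇ k))
    ... | true rewrite noFiles⇒noFileLeftOfRook p noFiles =
      cong ((countRooks p ≡ᵇ k) ∧_) (sym (∧-identityʳ (rooksNonAttacking p)))

  fileOnly≡noRooks : ∀ p → fileOnly p ≡ (countRooks p ≡ᵇ 0)
  fileOnly≡noRooks []           = refl
  fileOnly≡noRooks (empty  ∷ p) = fileOnly≡noRooks p
  fileOnly≡noRooks (rook i ∷ p) = refl
  fileOnly≡noRooks (file i ∷ p) = fileOnly≡noRooks p

  noRooks⇒rookInRow : ∀ i p → (countRooks p ≡ᵇ 0) ≡ true → rookInRow i p ≡ false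
  noRooks⇒rookInRow i []           _ = refl
  noRooks⇒rookInRow i (empty  ∷ p) = noRooks⇒rookInRow i p
  noRooks⇒rookInRow i (file j ∷ p) = noRooks⇒rookInRow i p

  noRooks⇒rooksNonAttacking : ∀ p → (countRooks p ≡ᵇ 0) ≡ true → rooksNonAttacking p ≡ true
  noRooks⇒rooksNonAttacking []           _ = refl
  noRooks⇒rooksNonAttacking (empty  ∷ p) = noRooks⇒rooksNonAttacking p
  noRooks⇒rooksNonAttacking (file j ∷ p) = noRooks⇒rooksNonAttacking p

  noRooks⇒noFileLeftOfRook : ∀ p → (countRooks p ≡ᵇ 0) ≡ true → noFileLeftOfRook p ≡ true
  noRooks⇒noFileLeftOfRook []           _ = refl
  noRooks⇒noFileLeftOfRook (empty  ∷ p) = noRooks⇒noFileLeftOfRook p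
  noRooks⇒noFileLeftOfRook (file j ∷ p) noRooks
    rewrite noRooks⇒rookInRow j p noRooks = noRooks⇒noFileLeftOfRook p noRooks

  f≡M : ∀ ℓ B → f ℓ B ≡ M 0 ℓ B
  f≡M ℓ B = begin
    f ℓ B                                                 ≡⟨ length-filterᵇ _ (assignments B) ⟩
    count (λ p → fileOnly p ∧ (countFiles p ≡ᵇ ℓ)) B      ≡⟨ count-cong B same ⟩
    count (isMixed 0 ℓ) B                                 ≡⟨ M≡count 0 ℓ B ⟨
    M 0 ℓ B                                               ∎
    where
    same : ∀ p → fileOnly p ∧ (countFiles p ≡ᵇ ℓ) ≡ isMixed 0 ℓ p
    same p rewrite fileOnly≡noRooks p with countRooks p ≡ᵇ 0 in noRooks
    ... | false = refl
    ... | true rewrite noRooks⇒rooksNonAttacking p noRooks | noRooks⇒noFileLeftOfRook p noRooks =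
      sym (∧-identityʳ (countFiles p ≡ᵇ ℓ))

  M-0-0 : ∀ n → M 0 0 (J n) ≡ 1
  M-0-0 zero    = refl
  M-0-0 (suc n) = trans (M-J-suc n 0 0) (trans (+-identityʳ _) (M-0-0 n))

  M-above-diagonal : ∀ {n k} ℓ → n < k → M k ℓ (J n) ≡ 0
  M-above-diagonal {zero}  {suc k} ℓ _          = refl
  M-above-diagonal {suc n} {suc k} ℓ (s≤s n<k) = begin
    M (suc k) ℓ (J (suc n))
      ≡⟨ M-J-suc n (suc k) ℓ ⟩
    M (suc k) ℓ (J n) + (rookInFirstColumn n (suc k) ℓ + fileInFirstColumn n (suc k) ℓ)
      ≡⟨ cong₂ _+_ (M-above-diagonal ℓ (m<n⇒m<1+n n<k)) (cong₂ _+_ no-rook (no-file ℓ)) ⟩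
    0 ∎
    where
    no-rook : rookInFirstColumn n (suc k) ℓ ≡ 0
    no-rook = cong (_* M k ℓ (J n)) (m≤n⇒m∸n≡0 (<⇒≤ n<k))
    no-file : ∀ ℓ → fileInFirstColumn n (suc k) ℓ ≡ 0
    no-file zero    = refl
    no-file (suc ℓ) = cong (_* M (suc k) ℓ (J n)) (m≤n⇒m∸n≡0 (m≤n⇒m≤1+n (<⇒≤ n<k)))

  M-J-factorises : ∀ n k ℓ → M k ℓ (J n) ≡ M k 0 (J n) * M 0 ℓ (J (n ∸ k))
  M-J-factorises n zero ℓ = begin
    M 0 ℓ (J n)                 ≡⟨ *-identityˡ _ ⟨
    1 * M 0 ℓ (J n)             ≡⟨ cong (_* M 0 ℓ (J n)) (M-0-0 n) ⟨
    M 0 0 (J n) * M 0 ℓ (J n)   ∎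
  M-J-factorises n (suc k) zero = begin
    M (suc k) 0 (J n)                                ≡⟨ *-identityʳ _ ⟨
    M (suc k) 0 (J n) * 1                            ≡⟨ cong (M (suc k) 0 (J n) *_) (M-0-0 (n ∸ suc k)) ⟨
    M (suc k) 0 (J n) * M 0 0 (J (n ∸ suc k))        ∎
  M-J-factorises zero    (suc k) (suc ℓ) = refl
  M-J-factorises (suc n) (suc k) (suc ℓ) = begin
    M (suc k) (suc ℓ) (J (suc n))
      ≡⟨ M-J-suc n (suc k) (suc ℓ) ⟩
    M (suc k) (suc ℓ) (J n) + (c * M k (suc ℓ) (J n) + m * M (suc k) ℓ (J n))
      ≡⟨ cong₂ _+_ (ih (suc k) (suc ℓ)) (cong₂ _+_ (cong (c *_) (ih k (suc ℓ))) (cong (m *_) (ih (suc k) ℓ))) ⟩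
    A * F (suc ℓ) m + (c * (a * F (suc ℓ) c) + m * (A * F ℓ m))
      ≡⟨ rearrange A (F (suc ℓ) m) c a (F (suc ℓ) c) m (F ℓ m) ⟩
    A * (F (suc ℓ) m + m * F ℓ m) + c * a * F (suc ℓ) c
      ≡⟨ cong (_+ c * a * F (suc ℓ) c) file-step ⟨
    A * F (suc ℓ) c + c * a * F (suc ℓ) c
      ≡⟨ *-distribʳ-+ (F (suc ℓ) c) A (c * a) ⟨
    (A + c * a) * F (suc ℓ) c
      ≡⟨ cong (_* F (suc ℓ) c) rook-step ⟨
    M (suc k) 0 (J (suc n)) * F (suc ℓ) c ∎
    where
    ih = M-J-factorises n
    c = n ∸ k
    m = n ∸ suc k
    A = M (suc k) 0 (J n)
    a = M k 0 (J n)
    F : ℕ → ℕ → ℕ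
    F ℓ x = M 0 ℓ (J x)
    rearrange : ∀ A B c a D m E → A * B + (c * (a * D) + m * (A * E)) ≡ A * (B + m * E) + c * a * D
    rearrange = solve-∀
    rook-step : M (suc k) 0 (J (suc n)) ≡ A + c * a
    rook-step = trans (M-J-suc n (suc k) 0) (cong (A +_) (+-identityʳ _))
    file-step : A * F (suc ℓ) c ≡ A * (F (suc ℓ) m + m * F ℓ m)
    file-step with k <? n
    ... | yes k<n rewrite sym (suc[n∸suc-k]≡n∸k k<n) = cong (A *_) (M-J-suc m 0 (suc ℓ))
    ... | no  k≮n rewrite M-above-diagonal {n} {suc k} 0 (s≤s (≮⇒≥ k≮n)) = refl

  M≡r*f : ∀ n k ℓ → M k ℓ (J n) ≡ r k (J n) * f ℓ (J (n ∸ k))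
  M≡r*f n k ℓ = trans (M-J-factorises n k ℓ) (sym (cong₂ _*_ (r≡M k (J n)) (f≡M ℓ (J (n ∸ k)))))

record WeightedTriangle : Set where
  field
    weight entry  : ℕ → ℕ → ℕ
    entry-0-0     : entry 0 0 ≡ 1
    entry-0-suc   : ∀ k → entry 0 (suc k) ≡ 0
    entry-suc-0   : ∀ n → entry (suc n) 0 ≡ weight n 0 ℕ.* entry n 0
    entry-suc-suc : ∀ n k →
      entry (suc n) (suc k) ≡ weight n (suc k) ℕ.* entry n (suc k) ℕ.+ entry n k

  entry-above-diagonal : ∀ {n k} → n < k → entry n k ≡ 0
  entry-above-diagonal {zero}  {suc k} _          = entry-0-suc k
  entry-above-diagonal {suc n} {suc k} (s≤s n<k)
    rewrite entry-suc-suc n k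
          | entry-above-diagonal (m<n⇒m<1+n n<k)
          | entry-above-diagonal n<k = ≡.cong (ℕ._+ 0) (*-zeroʳ (weight n (suc k)))

stirling₂ : WeightedTriangle
stirling₂ = record
  { weight = λ _ k → k ; entry = S₂
  ; entry-0-0 = ≡.refl ; entry-0-suc = λ _ → ≡.refl
  ; entry-suc-0 = λ _ → ≡.refl ; entry-suc-suc = λ _ _ → ≡.refl }

c₁-suc-0 : ∀ n → c₁ (suc n) 0 ≡ n ℕ.* c₁ n 0
c₁-suc-0 zero    = ≡.refl
c₁-suc-0 (suc n) = ≡.sym (*-zeroʳ (suc n))

stirling₁ : WeightedTriangle
stirling₁ = record
  { weight = λ n _ → n ; entry = c₁
  ; entry-0-0 = ≡.refl ; entry-0-suc = λ _ → ≡.refl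
  ; entry-suc-0 = c₁-suc-0 ; entry-suc-suc = λ _ _ → ≡.refl }

module NormalOrdering {c ℓ} (R : Ring c ℓ) where

  open Ring R
  open import Algebra.Properties.Semiring.Sum semiring
    using (sum; sum-cong-≋; ∑-distrib-+; *-distribˡ-sum)
  open import Algebra.Properties.Semiring.Mult semiring
    using (_×_; ×-congʳ; ×-congˡ; ×-homo-1; ×-homo-+; ×-assocˡ; ×-comm-*; ×-assoc-*)
  open import Algebra.Definitions.RawSemiring (Semiring.rawSemiring semiring) using (_^_)
  open import Algebra.Properties.CommutativeSemigroup +-commutativeSemigroup using (x∙yz≈y∙xz; x∙yz≈xz∙y)
  open import Algebra.Properties.CommutativeMonoid.Mult +-commutativeMonoid using (×-distrib-+)
  open import Relation.Binary.Reasoning.Setoid setoid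

  ∑≤ : ℕ → (ℕ → Carrier) → Carrier
  ∑≤ n g = sum {suc n} (λ i → g (toℕ i))

  ∑≤-cong : ∀ n {g h : ℕ → Carrier} → (∀ k → g k ≈ h k) → ∑≤ n g ≈ ∑≤ n h
  ∑≤-cong n g≈h = sum-cong-≋ {suc n} (λ i → g≈h (toℕ i))

  ∑≤-+ : ∀ n (g h : ℕ → Carrier) → ∑≤ n (λ k → g k + h k) ≈ ∑≤ n g + ∑≤ n h
  ∑≤-+ n g h = ∑-distrib-+ {suc n} (λ i → g (toℕ i)) (λ i → h (toℕ i))

  *-distribˡ-∑≤ : ∀ n x (g : ℕ → Carrier) → x * ∑≤ n g ≈ ∑≤ n (λ k → x * g k)
  *-distribˡ-∑≤ n x g = *-distribˡ-sum {suc n} x (λ i → g (toℕ i))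

  ∑≤-last : ∀ n (g : ℕ → Carrier) → ∑≤ (suc n) g ≈ ∑≤ n g + g (suc n)
  ∑≤-last zero    g = trans (+-congˡ (+-identityʳ (g 1))) (+-congʳ (sym (+-identityʳ (g 0))))
  ∑≤-last (suc n) g = trans (+-congˡ (∑≤-last n (λ k → g (suc k)))) (sym (+-assoc _ _ _))

  ∑≤-vanishing-last : ∀ n (g : ℕ → Carrier) → g (suc n) ≈ 0# → ∑≤ (suc n) g ≈ ∑≤ n g
  ∑≤-vanishing-last n g g≈0 = trans (∑≤-last n g) (trans (+-congˡ g≈0) (+-identityʳ _))

  Central : Carrier → Set _
  Central z = ∀ w → z * w ≈ w * z

  x*[z*y]≈z*[x*y] : ∀ {z} → Central z → ∀ x y → x * (z * y) ≈ z * (x * y)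
  x*[z*y]≈z*[x*y] {z} cz x y = begin
    x * (z * y) ≈⟨ *-assoc x z y ⟨
    (x * z) * y ≈⟨ *-congʳ (cz x) ⟨
    (z * x) * y ≈⟨ *-assoc z x y ⟩
    z * (x * y) ∎

  central-0 : Central 0#
  central-0 w = trans (zeroˡ w) (sym (zeroʳ w))

  central-1 : Central 1#
  central-1 w = trans (*-identityˡ w) (sym (*-identityʳ w))

  central-+ : ∀ {x y} → Central x → Central y → Central (x + y)
  central-+ {x} {y} cx cy w = trans (distribʳ w x y) (trans (+-cong (cx w) (cy w)) (sym (distribˡ w x y)))

  central-* : ∀ {x y} → Central x → Central y → Central (x * y)
  central-* {x} {y} cx cy w = begin
    (x * y) * w ≈⟨ *-assoc x y w ⟩
    x * (y * w) ≈⟨ *-congˡ (cy w) ⟩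
    x * (w * y) ≈⟨ *-assoc x w y ⟨
    (x * w) * y ≈⟨ *-congʳ (cx w) ⟩
    (w * x) * y ≈⟨ *-assoc w x y ⟩
    w * (x * y) ∎

  central-^ : ∀ {x} → Central x → ∀ n → Central (x ^ n)
  central-^ cx zero    = central-1
  central-^ cx (suc n) = central-* cx (central-^ cx n)

  central-× : ∀ {x} → Central x → ∀ n → Central (n × x)
  central-× cx zero    = central-0
  central-× cx (suc n) = central-+ cx (central-× cx n)

  orderedProduct : (ℕ → Carrier) → ℕ → Carrier
  orderedProduct T zero    = 1#
  orderedProduct T (suc n) = T n * orderedProduct T n

  module _ (W : WeightedTriangle) {s : Carrier} (s-central : Central s) where

    open WeightedTriangle W

    coeff : ℕ → ℕ → Carrier
    coeff n k = entry n k × s ^ (n ℕ.∸ k)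

    coeff-central : ∀ n k → Central (coeff n k)
    coeff-central n k = central-× (central-^ s-central (n ℕ.∸ k)) (entry n k)

    coeff-0-0 : coeff 0 0 ≈ 1#
    coeff-0-0 = trans (×-congˡ entry-0-0) (×-homo-1 1#)

    coeff-above-diagonal : ∀ n → coeff n (suc n) ≈ 0#
    coeff-above-diagonal n = ×-congˡ (entry-above-diagonal (n<1+n n))

    coeff-suc-0 : ∀ n → coeff (suc n) 0 ≈ weight n 0 × (s * coeff n 0)
    coeff-suc-0 n = begin
      entry (suc n) 0 × (s * s ^ n)               ≈⟨ ×-congˡ (entry-suc-0 n) ⟩
      (weight n 0 ℕ.* entry n 0) × (s * s ^ n)   ≈⟨ ×-assocˡ _ (weight n 0) (entry n 0) ⟨
      weight n 0 × (entry n 0 × (s * s ^ n))     ≈⟨ ×-congʳ (weight n 0) (×-comm-* (entry n 0) s (s ^ n)) ⟨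
      weight n 0 × (s * coeff n 0)               ∎

    -- Junk exponents: when k ≥ n the truncated subtraction n ∸ k is off by one, but then entry n (suc k) = 0.
    s*coeff-suc : ∀ n k → s * coeff n (suc k) ≈ entry n (suc k) × s ^ (n ℕ.∸ k)
    s*coeff-suc n k with k ℕ.<? n
    ... | yes k<n = begin
      s * (e × s ^ (n ℕ.∸ suc k))  ≈⟨ ×-comm-* e s _ ⟩
      e × (s ^ suc (n ℕ.∸ suc k))  ≈⟨ ×-congʳ e (reflexive (≡.cong (s ^_) (suc[n∸suc-k]≡n∸k k<n))) ⟩
      e × s ^ (n ℕ.∸ k)            ∎
      where e = entry n (suc k)
    ... | no k≮n rewrite entry-above-diagonal {n} {suc k} (s≤s (≮⇒≥ k≮n)) = zeroʳ s

    coeff-suc-suc : ∀ n k → coeff (suc n) (suc k) ≈ coeff n k + weight n (suc k) × (s * coeff n (suc k))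
    coeff-suc-suc n k = begin
      entry (suc n) (suc k) × s ^ (n ℕ.∸ k)                ≈⟨ ×-congˡ (entry-suc-suc n k) ⟩
      (w ℕ.* entry n (suc k) ℕ.+ entry n k) × s ^ (n ℕ.∸ k) ≈⟨ ×-homo-+ _ (w ℕ.* entry n (suc k)) (entry n k) ⟩
      (w ℕ.* entry n (suc k)) × s ^ (n ℕ.∸ k) + coeff n k  ≈⟨ +-congʳ (×-assocˡ _ w (entry n (suc k))) ⟨
      w × (entry n (suc k) × s ^ (n ℕ.∸ k)) + coeff n k    ≈⟨ +-congʳ (×-congʳ w (s*coeff-suc n k)) ⟨
      w × (s * coeff n (suc k)) + coeff n k                ≈⟨ +-comm _ _ ⟩
      coeff n k + w × (s * coeff n (suc k))                ∎
      where w = weight n (suc k)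

    module _ (T P : ℕ → Carrier) (P-0 : P 0 ≈ 1#)
             (T*P : ∀ n k → T n * P k ≈ P (suc k) + weight n k × (s * P k)) where

      private
        drift : ℕ → ℕ → Carrier
        drift n k = (weight n k × (s * coeff n k)) * P k

        T*coeff*P : ∀ n k → T n * (coeff n k * P k) ≈ coeff n k * P (suc k) + drift n k
        T*coeff*P n k = begin
          T n * (a * P k)                         ≈⟨ x*[z*y]≈z*[x*y] (coeff-central n k) (T n) (P k) ⟩
          a * (T n * P k)                         ≈⟨ *-congˡ (T*P n k) ⟩
          a * (P (suc k) + w × (s * P k))         ≈⟨ distribˡ a _ _ ⟩
          a * P (suc k) + a * (w × (s * P k))     ≈⟨ +-congˡ (×-comm-* w a _) ⟩
          a * P (suc k) + w × (a * (s * P k))     ≈⟨ +-congˡ (×-congʳ w (x*[z*y]≈z*[x*y] s-central a (P k))) ⟩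
          a * P (suc k) + w × (s * (a * P k))     ≈⟨ +-congˡ (×-congʳ w (*-assoc s a (P k))) ⟨
          a * P (suc k) + w × ((s * a) * P k)     ≈⟨ +-congˡ (×-assoc-* w (s * a) (P k)) ⟨
          a * P (suc k) + drift n k               ∎
          where a = coeff n k
                w = weight n k

      orderedProduct-expansion : ∀ n → orderedProduct T n ≈ ∑≤ n (λ k → coeff n k * P k)
      orderedProduct-expansion zero = begin
        1#                  ≈⟨ P-0 ⟨
        P 0                 ≈⟨ *-identityˡ (P 0) ⟨
        1# * P 0            ≈⟨ *-congʳ coeff-0-0 ⟨
        coeff 0 0 * P 0     ≈⟨ +-identityʳ _ ⟨
        coeff 0 0 * P 0 + 0# ∎
      orderedProduct-expansion (suc n) = begin
        T n * orderedProduct T n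
          ≈⟨ *-congˡ (orderedProduct-expansion n) ⟩
        T n * ∑≤ n (λ k → coeff n k * P k)
          ≈⟨ *-distribˡ-∑≤ n (T n) (λ k → coeff n k * P k) ⟩
        ∑≤ n (λ k → T n * (coeff n k * P k))
          ≈⟨ ∑≤-cong n (T*coeff*P n) ⟩
        ∑≤ n (λ k → raised k + drift n k)
          ≈⟨ ∑≤-+ n raised (drift n) ⟩
        ∑≤ n raised + ∑≤ n (drift n)
          ≈⟨ +-congˡ (∑≤-vanishing-last n (drift n) drift-last) ⟨
        ∑≤ n raised + (drift n 0 + ∑≤ n (λ k → drift n (suc k)))
          ≈⟨ x∙yz≈y∙xz _ _ _ ⟩
        drift n 0 + (∑≤ n raised + ∑≤ n (λ k → drift n (suc k)))
          ≈⟨ +-congˡ (∑≤-+ n raised (λ k → drift n (suc k))) ⟨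
        drift n 0 + ∑≤ n (λ k → raised k + drift n (suc k))
          ≈⟨ +-cong first (∑≤-cong n rest) ⟩
        coeff (suc n) 0 * P 0 + ∑≤ n (λ k → coeff (suc n) (suc k) * P (suc k)) ∎
        where
        raised : ℕ → Carrier
        raised k = coeff n k * P (suc k)
        drift-last : drift n (suc n) ≈ 0#
        drift-last = begin
          (w × (s * coeff n (suc n))) * P (suc n) ≈⟨ ×-assoc-* w _ _ ⟩
          w × ((s * coeff n (suc n)) * P (suc n)) ≈⟨ ×-congʳ w (*-congʳ s*coeff≈0) ⟩
          w × (0# * P (suc n))                    ≈⟨ ×-comm-* w 0# _ ⟨
          0# * (w × P (suc n))                    ≈⟨ zeroˡ _ ⟩
          0#                                      ∎
          where
          w = weight n (suc n)
          s*coeff≈0 = trans (*-congˡ (coeff-above-diagonal n)) (zeroʳ s)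
        first : drift n 0 ≈ coeff (suc n) 0 * P 0
        first = *-congʳ (sym (coeff-suc-0 n))
        rest : ∀ k → raised k + drift n (suc k) ≈ coeff (suc n) (suc k) * P (suc k)
        rest k = trans (sym (distribʳ (P (suc k)) _ _)) (*-congʳ (sym (coeff-suc-suc n k)))

  orderedProduct-const : ∀ x n → orderedProduct (λ _ → x) n ≈ x ^ n
  orderedProduct-const x zero    = refl
  orderedProduct-const x (suc n) = *-congˡ (orderedProduct-const x n)

  ×-*-× : ∀ a b x y → (a × x) * (b × y) ≈ (a ℕ.* b) × (x * y)
  ×-*-× a b x y = begin
    (a × x) * (b × y)  ≈⟨ ×-assoc-* a x (b × y) ⟩
    a × (x * (b × y))  ≈⟨ ×-congʳ a (×-comm-* b x y) ⟩
    a × (b × (x * y))  ≈⟨ ×-assocˡ (x * y) a b ⟩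
    (a ℕ.* b) × (x * y) ∎

  module _ {μ ν X Y : Carrier} (μ-central : Central μ) (ν-central : Central ν)
           (XY-YX : X * Y - Y * X ≈ μ + ν * Y) where

    rising : ℕ → Carrier
    rising = orderedProduct (λ j → X + j × ν)

    rising-expansion : ∀ r → rising r ≈ ∑≤ r (λ t → (c₁ r t × ν ^ (r ℕ.∸ t)) * X ^ t)
    rising-expansion = orderedProduct-expansion stirling₁ ν-central (λ j → X + j × ν) (X ^_) refl
      (λ r t → trans (distribʳ (X ^ t) X (r × ν)) (+-congˡ (×-assoc-* r ν (X ^ t))))

    L : Carrier
    L = μ + ν * Y

    XY≈YX+L : X * Y ≈ Y * X + L
    XY≈YX+L = begin
      X * Y                       ≈⟨ +-identityʳ (X * Y) ⟨
      X * Y + 0#                  ≈⟨ +-congˡ (-‿inverseˡ (Y * X)) ⟨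
      X * Y + (- (Y * X) + Y * X) ≈⟨ +-assoc (X * Y) (- (Y * X)) (Y * X) ⟨
      (X * Y - Y * X) + Y * X     ≈⟨ +-congʳ XY-YX ⟩
      L + Y * X                   ≈⟨ +-comm L (Y * X) ⟩
      Y * X + L                   ∎

    LY≈YL : L * Y ≈ Y * L
    LY≈YL = begin
      (μ + ν * Y) * Y      ≈⟨ distribʳ Y μ (ν * Y) ⟩
      μ * Y + (ν * Y) * Y  ≈⟨ +-cong (μ-central Y) (trans (*-congʳ (ν-central Y)) (*-assoc Y ν Y)) ⟩
      Y * μ + Y * (ν * Y)  ≈⟨ distribˡ Y μ (ν * Y) ⟨
      Y * (μ + ν * Y)      ∎

    Y*X*Y^r : ∀ r → Y * (X * Y ^ r) ≈ Y ^ suc r * X + r × (L * Y ^ r)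
    Y*X*Y^r zero = begin
      Y * (X * 1#)      ≈⟨ *-congˡ (*-identityʳ X) ⟩
      Y * X             ≈⟨ *-congʳ (*-identityʳ Y) ⟨
      (Y * 1#) * X      ≈⟨ +-identityʳ _ ⟨
      (Y * 1#) * X + 0# ∎
    Y*X*Y^r (suc r) = begin
      Y * (X * (Y * Yʳ))                            ≈⟨ *-congˡ (*-assoc X Y Yʳ) ⟨
      Y * ((X * Y) * Yʳ)                            ≈⟨ *-congˡ (*-congʳ XY≈YX+L) ⟩
      Y * ((Y * X + L) * Yʳ)                        ≈⟨ *-congˡ (distribʳ Yʳ (Y * X) L) ⟩
      Y * ((Y * X) * Yʳ + L * Yʳ)                   ≈⟨ distribˡ Y _ _ ⟩
      Y * ((Y * X) * Yʳ) + Y * (L * Yʳ)             ≈⟨ +-cong (*-congˡ (*-assoc Y X Yʳ)) Y*L*Yʳ ⟩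
      Y * (Y * (X * Yʳ)) + L * (Y * Yʳ)             ≈⟨ +-congʳ (*-congˡ (Y*X*Y^r r)) ⟩
      Y * (Y ^ suc r * X + r × (L * Yʳ)) + L * (Y * Yʳ)
                                                    ≈⟨ +-congʳ (distribˡ Y _ _) ⟩
      (Y * (Y ^ suc r * X) + Y * (r × (L * Yʳ))) + L * (Y * Yʳ)
                                                    ≈⟨ +-congʳ (+-cong (sym (*-assoc Y (Y ^ suc r) X)) Y*[r×L*Yʳ]) ⟩
      ((Y * Y ^ suc r) * X + r × (L * (Y * Yʳ))) + L * (Y * Yʳ)
                                                    ≈⟨ +-assoc _ _ _ ⟩
      (Y * Y ^ suc r) * X + (r × (L * (Y * Yʳ)) + L * (Y * Yʳ))
                                                    ≈⟨ +-congˡ (+-comm _ _) ⟩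
      Y ^ suc (suc r) * X + suc r × (L * Y ^ suc r) ∎
      where
      Yʳ = Y ^ r
      Y*L*Yʳ : Y * (L * Yʳ) ≈ L * (Y * Yʳ)
      Y*L*Yʳ = begin
        Y * (L * Yʳ) ≈⟨ *-assoc Y L Yʳ ⟨
        (Y * L) * Yʳ ≈⟨ *-congʳ LY≈YL ⟨
        (L * Y) * Yʳ ≈⟨ *-assoc L Y Yʳ ⟩
        L * (Y * Yʳ) ∎
      Y*[r×L*Yʳ] : Y * (r × (L * Yʳ)) ≈ r × (L * (Y * Yʳ))
      Y*[r×L*Yʳ] = trans (×-comm-* r Y (L * Yʳ)) (×-congʳ r Y*L*Yʳ)

    P : ℕ → Carrier
    P r = Y ^ r * rising r

    L*Y^r*Q : ∀ r Q → (L * Y ^ r) * Q ≈ μ * (Y ^ r * Q) + ν * (Y ^ suc r * Q)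
    L*Y^r*Q r Q = begin
      (L * Y ^ r) * Q                      ≈⟨ *-assoc L (Y ^ r) Q ⟩
      (μ + ν * Y) * (Y ^ r * Q)            ≈⟨ distribʳ _ μ (ν * Y) ⟩
      μ * (Y ^ r * Q) + (ν * Y) * (Y ^ r * Q) ≈⟨ +-congˡ (*-assoc ν Y _) ⟩
      μ * (Y ^ r * Q) + ν * (Y * (Y ^ r * Q)) ≈⟨ +-congˡ (*-congˡ (*-assoc Y (Y ^ r) Q)) ⟨
      μ * (Y ^ r * Q) + ν * (Y ^ suc r * Q) ∎

    Y^r*[X+mν]*Q : ∀ r m Q → Y ^ r * ((X + m × ν) * Q) ≈ (Y ^ r * X) * Q + m × (ν * (Y ^ r * Q))
    Y^r*[X+mν]*Q r m Q = begin
      Y ^ r * ((X + m × ν) * Q)              ≈⟨ *-congˡ (distribʳ Q X (m × ν)) ⟩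
      Y ^ r * (X * Q + (m × ν) * Q)          ≈⟨ distribˡ (Y ^ r) _ _ ⟩
      Y ^ r * (X * Q) + Y ^ r * ((m × ν) * Q) ≈⟨ +-cong (sym (*-assoc (Y ^ r) X Q)) (*-congˡ (×-assoc-* m ν Q)) ⟩
      (Y ^ r * X) * Q + Y ^ r * (m × (ν * Q)) ≈⟨ +-congˡ (×-comm-* m (Y ^ r) (ν * Q)) ⟩
      (Y ^ r * X) * Q + m × (Y ^ r * (ν * Q)) ≈⟨ +-congˡ (×-congʳ m (x*[z*y]≈z*[x*y] ν-central (Y ^ r) Q)) ⟩
      (Y ^ r * X) * Q + m × (ν * (Y ^ r * Q)) ∎

    YX*P : ∀ r → (Y * X) * P r ≈ P (suc r) + r × (μ * P r)
    YX*P r = begin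
      (Y * X) * (Y ^ r * Q)                                        ≈⟨ *-assoc Y X _ ⟩
      Y * (X * (Y ^ r * Q))                                        ≈⟨ *-congˡ (*-assoc X (Y ^ r) Q) ⟨
      Y * ((X * Y ^ r) * Q)                                        ≈⟨ *-assoc Y _ Q ⟨
      (Y * (X * Y ^ r)) * Q                                        ≈⟨ *-congʳ (Y*X*Y^r r) ⟩
      (Y ^ suc r * X + r × (L * Y ^ r)) * Q                        ≈⟨ distribʳ Q _ _ ⟩
      (Y ^ suc r * X) * Q + (r × (L * Y ^ r)) * Q                  ≈⟨ +-congˡ (×-assoc-* r _ Q) ⟩
      (Y ^ suc r * X) * Q + r × ((L * Y ^ r) * Q)                  ≈⟨ +-congˡ (×-congʳ r (L*Y^r*Q r Q)) ⟩
      (Y ^ suc r * X) * Q + r × (μ * P r + ν * (Y ^ suc r * Q))    ≈⟨ +-congˡ (×-distrib-+ _ _ r) ⟩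
      (Y ^ suc r * X) * Q + (r × (μ * P r) + r × (ν * (Y ^ suc r * Q)))
                                                                   ≈⟨ x∙yz≈xz∙y _ _ _ ⟩
      ((Y ^ suc r * X) * Q + r × (ν * (Y ^ suc r * Q))) + r × (μ * P r)
                                                                   ≈⟨ +-congʳ (Y^r*[X+mν]*Q (suc r) r Q) ⟨
      P (suc r) + r × (μ * P r)                                    ∎
      where Q = rising r

    YX^n-expansion : ∀ n → (Y * X) ^ n ≈ ∑≤ n (λ r → (S₂ n r × μ ^ (n ℕ.∸ r)) * P r)
    YX^n-expansion n = begin
      (Y * X) ^ n                      ≈⟨ orderedProduct-const (Y * X) n ⟨
      orderedProduct (λ _ → Y * X) n
        ≈⟨ orderedProduct-expansion stirling₂ μ-central (λ _ → Y * X) P (*-identityˡ 1#) (λ _ → YX*P) n ⟩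
      ∑≤ n (λ r → (S₂ n r × μ ^ (n ℕ.∸ r)) * P r) ∎

    normalTerm : ℕ → ℕ → ℕ → Carrier
    normalTerm n r t = ((S₂ n r ℕ.* c₁ r t) × (μ ^ (n ℕ.∸ r) * ν ^ (r ℕ.∸ t))) * (Y ^ r * X ^ t)

    normal-ordering : ∀ n → (Y * X) ^ n ≈ ∑≤ n (λ r → ∑≤ r (normalTerm n r))
    normal-ordering n = trans (YX^n-expansion n) (∑≤-cong n expand)
      where
      expand : ∀ r → (S₂ n r × μ ^ (n ℕ.∸ r)) * P r ≈ ∑≤ r (normalTerm n r)
      expand r = begin
        a * (Y ^ r * rising r)                   ≈⟨ *-congˡ (*-congˡ (rising-expansion r)) ⟩
        a * (Y ^ r * ∑≤ r b)                     ≈⟨ *-congˡ (*-distribˡ-∑≤ r (Y ^ r) b) ⟩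
        a * ∑≤ r (λ t → Y ^ r * b t)             ≈⟨ *-distribˡ-∑≤ r a (λ t → Y ^ r * b t) ⟩
        ∑≤ r (λ t → a * (Y ^ r * b t))           ≈⟨ ∑≤-cong r merge ⟩
        ∑≤ r (normalTerm n r)                    ∎
        where
        a = S₂ n r × μ ^ (n ℕ.∸ r)
        e : ℕ → Carrier
        e t = c₁ r t × ν ^ (r ℕ.∸ t)
        b : ℕ → Carrier
        b t = e t * X ^ t
        merge : ∀ t → a * (Y ^ r * b t) ≈ normalTerm n r t
        merge t = begin
          a * (Y ^ r * (e t * X ^ t))  ≈⟨ *-congˡ (x*[z*y]≈z*[x*y] e-central (Y ^ r) (X ^ t)) ⟩
          a * (e t * (Y ^ r * X ^ t))  ≈⟨ *-assoc a (e t) _ ⟨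
          (a * e t) * (Y ^ r * X ^ t)  ≈⟨ *-congʳ (×-*-× (S₂ n r) (c₁ r t) _ _) ⟩
          normalTerm n r t             ∎
          where e-central = central-× (central-^ ν-central (r ℕ.∸ t)) (c₁ r t)

open import Data.Nat using (ℕ; _≤_; _∸_; _*_)
open import Data.Product using (_×_)
open import Relation.Binary.PropositionalEquality using (_≡_)
open import Algebra.Bundles using (Ring)
open import Level using (Level)

proposition2p8 : {a b : Level} →
    ((n k ℓ : ℕ) → k ≤ n → M k ℓ (J n) ≡ r k (J n) * f ℓ (J (n ∸ k)))
    × ((R : Ring a b) (μ ν X Y : Ring.Carrier R)
       → (∀ z → Ring._≈_ R (Ring._*_ R μ z) (Ring._*_ R z μ))
       → (∀ z → Ring._≈_ R (Ring._*_ R ν z) (Ring._*_ R z ν))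
       → Ring._≈_ R (Ring._-_ R (Ring._*_ R X Y) (Ring._*_ R Y X))
                    (Ring._+_ R μ (Ring._*_ R ν Y))
       → (n : ℕ) → Ring._≈_ R (YXpow R X Y n) (normalOrderedSum R μ ν X Y n))
proposition2p8 = (λ n k ℓ _ → Placements.M≡r*f n k ℓ)
               , (λ R μ ν X Y → NormalOrdering.normal-ordering R)
  where open import Data.Product using (_,_)
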